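{- Let $d\ge 2$ and $N>d$ be integers such that $d$ divides $N$, and let $u$ and $v$ be two distinct de Bruijn cycles of $G_B(N,d)$. Then there exists a de Bruijn cycle $u_1$ which is adjacent to $u$ in the cross-join graph $\mathcal{C}(N,d)$ such that $\mathcal{D}(u_1,v)<\mathcal{D}(u,v)$.
   Context: For integers $d\ge2$ and $N>d$, the generalized de Bruijn digraph $G_B(N,d)$ has vertex set $V=\{0,1,\ldots,N-1\}$, and $(x,y)$ is an edge iff $y\equiv dx+r \pmod N$ for some $r\in\{0,1,\ldots,d-1\}$; then $y$ is a successor of $x$. A de Bruijn cycle is a Hamiltonian cycle of $G_B(N,d)$; it is written as the sequence of its vertices $(x_1,x_2,\ldots,x_N)$ starting at $x_1=0$. For two de Bruijn cycles $u,v$ written this way, $\mathcal{D}(u,v)=N-L$, where $L$ is the largest integer such that the first $L$ vertices of $u$ and $v$ coincide. Two distinct vertices $x_1,x_2$ are conjugate if there exist two distinct vertices $y_1,y_2$ such that $(x_1,y_1),(x_1,y_2),(x_2,y_1),(x_2,y_2)$ are all edges. A cross-join operation on a de Bruijn cycle $u$: choose a conjugate pair $x_1,x_2$ on $u$ and interchange their successors on $u$ (replace the edges $x_1\to y_1$, $x_2\to y_2$ of $u$ by $x_1\to y_2$, $x_2\to y_1$), which splits $u$ into two disjoint cycles; then choose a conjugate pair $z_1,z_2$ with $z_1$ on one of these cycles and $z_2$ on the other and interchange their successors, obtaining a new Hamiltonian cycle. Two de Bruijn cycles are adjacent in the cross-join graph $\mathcal{C}(N,d)$ if one can be obtained from the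 other by a single cross-join operation. -}

module Defs where

open import Data.Nat using (ℕ; zero; suc; _+_; _*_; _∸_; _<_; _≟_)
open import Data.List using (List; []; _∷_; _++_; [_]; length)
open import Data.List.Relation.Unary.All using (All)
open import Data.List.Relation.Unary.Unique.Propositional using (Unique)
open import Data.Product using (Σ; ∃; _×_; _,_)
open import Data.Sum using (_⊎_)
open import Function using (_∘_)
open import Relation.Binary.PropositionalEquality using (_≡_; _≢_)
open import Relation.Nullary using (¬_; yes; no)

-- Edge of the generalized de Bruijn digraph G_B(N,d) on V = {0,…,N-1}:
-- (x,y) is an edge iff x,y ∈ V and y ≡ d*x + r (mod N) for some r < d
-- (for y < N this means d*x + r = q*N + y for some q).
Edge : (N d : ℕ) → ℕ → ℕ → Set
Edge N d x y = x < N × y < N × Σ ℕ λ r → r < d × Σ ℕ λ q → d * x + r ≡ q * N + y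

Adj : List ℕ → ℕ → ℕ → Set
Adj l x y = Σ (List ℕ) λ as → Σ (List ℕ) λ bs → l ≡ as ++ x ∷ y ∷ bs

-- y is the successor of x on the cycle written as the vertex list u
-- (starting at 0, so the last vertex is followed by 0)
Next : List ℕ → ℕ → ℕ → Set
Next u x y = Adj (u ++ [ 0 ]) x y

data Path (N d : ℕ) : List ℕ → Set where
  nil  : Path N d []
  one  : ∀ x → Path N d [ x ]
  cons : ∀ x y l → Edge N d x y → Path N d (y ∷ l) → Path N d (x ∷ y ∷ l)

-- A de Bruijn cycle (Hamiltonian cycle of G_B(N,d)) written as the
-- sequence of its vertices (x₁,…,x_N) with x₁ = 0.
record DBCycle (N d : ℕ) (u : List ℕ) : Set where
  field
    len     : length u ≡ N
    inV     : All (_< N) u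
    distinct : Unique u
    start   : Σ (List ℕ) λ rest → u ≡ 0 ∷ rest
    closed  : Path N d (u ++ [ 0 ])

lcp : List ℕ → List ℕ → ℕ
lcp [] _ = 0
lcp (_ ∷ _) [] = 0
lcp (x ∷ xs) (y ∷ ys) with x ≟ y
... | yes _ = suc (lcp xs ys)
... | no _ = 0

Dist : ℕ → List ℕ → List ℕ → ℕ
Dist N u v = N ∸ lcp u v

Conjugate : (N d : ℕ) → ℕ → ℕ → Set
Conjugate N d x₁ x₂ = x₁ ≢ x₂ × Σ ℕ λ y₁ → Σ ℕ λ y₂ → y₁ ≢ y₂ ×
  Edge N d x₁ y₁ × Edge N d x₁ y₂ × Edge N d x₂ y₁ × Edge N d x₂ y₂

swapSucc : (ℕ → ℕ) → ℕ → ℕ → ℕ → ℕ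
swapSucc f a b x with x ≟ a
... | yes _ = f b
... | no _ with x ≟ b
...   | yes _ = f a
...   | no _ = f x

iter : (ℕ → ℕ) → ℕ → ℕ → ℕ
iter f zero x = x
iter f (suc k) x = f (iter f k x)

SameCycle : (ℕ → ℕ) → ℕ → ℕ → Set
SameCycle f a b = Σ ℕ λ k → iter f k a ≡ b

-- u₁ is obtained from u by one cross-join operation: s is the successor
-- function of u; swapping successors of the conjugate pair x₁,x₂ splits
-- u into two cycles; z₁,z₂ is a conjugate pair on different ones of these
-- cycles; swapping their successors gives the successor function of u₁.
CrossJoin : (N d : ℕ) → List ℕ → List ℕ → Set
CrossJoin N d u u₁ =
  Σ (ℕ → ℕ) λ s → (∀ x → x < N → Next u x (s x)) ×
  Σ ℕ λ x₁ → Σ ℕ λ x₂ → Conjugate N d x₁ x₂ ×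
  Σ ℕ λ z₁ → Σ ℕ λ z₂ → Conjugate N d z₁ z₂ ×
  ¬ SameCycle (swapSucc s x₁ x₂) z₁ z₂ ×
  (∀ x → x < N → Next u₁ x (swapSucc (swapSucc s x₁ x₂) z₁ z₂ x))

CJAdjacent : (N d : ℕ) → List ℕ → List ℕ → Set
CJAdjacent N d u u₁ = CrossJoin N d u u₁ ⊎ CrossJoin N d u₁ u

module Submission where

-- Let u ≠ v be de Bruijn cycles of G_B(N,d) with d ∣ N, both written from 0.  Cut u at
-- the first position where it differs from v:  u = α β γ  and  v = α y₂ …,  where β runs
-- from the first differing vertex y₁ of u to the vertex x' that precedes y₂ on u, and γ
-- starts at y₂.  Writing N = p * d, the successors of a vertex x are exactly the vertices y
-- with y / d = x % p, so two vertices sharing one successor share all of them; this is the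
-- only place where d ∣ N is used.  The last vertex x of α and x' both precede y₂ (on v and
-- on u), hence they are conjugate, and swapping their successors splits u into the two
-- cycles α γ and β.  Following v from y₂ until it first enters β gives an edge w → b with
-- w ∈ γ and b ∈ β; w and the predecessor p of b on the cycle β share the successor b, and
-- swapping their successors joins the two cycles into
--     u₁ = α γ₁ w (b … p) γ₂        where γ = γ₁ w γ₂ and β rotated to start at b is b … p.
-- Since u₁ agrees with v on α y₂, 𝒟(u₁,v) < 𝒟(u,v).

open import Defs
open import Data.Nat using (ℕ; zero; suc; pred; _+_; _*_; _∸_; _≤_; _<_; _≟_; z≤n; s≤s; NonZero; >-nonZero; _/_; _%_)
open import Data.Nat.Properties using (+-comm; +-assoc; *-comm; +-identityʳ; <-irrefl; ≤-<-trans; ∸-monoʳ-≤; ∸-monoʳ-<; n<1+n; m<m+n; m*n≢0; m*n≢0⇒m≢0; module ≤-Reasoning)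
open import Data.Nat.Divisibility using (_∣_; divides; n∣m*n)
open import Data.Nat.DivMod using (m≡m%n+[m/n]*n; m<n⇒m%n≡m; [m+kn]%n≡m%n; m%n<n; m*n/n≡m; m<n⇒m/n≡0; +-distrib-/-∣ˡ; m%n*o≡m*o%[n*o]; [m*n+o]%[p*n]≡[m*n]%[p*n]+o)
open import Data.List using (List; []; _∷_; _++_; [_]; length; foldr; upTo)
open import Data.List.Properties using (++-assoc; ++-identityʳ; ∷-injective; ∷ʳ-injective; length-++; length-upTo; ++-monoid)
open import Data.List.Relation.Unary.All as All using (All; _∷_)
open import Data.List.Relation.Unary.Any using (Any; here; there)
open import Data.List.Relation.Unary.Unique.Propositional using (Unique; []; _∷_)
open import Data.List.Membership.Propositional using (_∈_; _∉_)
open import Data.List.Membership.Propositional.Properties using (∈-++⁺ˡ; ∈-++⁺ʳ; ∈-++⁻; ∈-∃++; ∈-upTo⁺)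
open import Data.List.Membership.DecPropositional _≟_ using (_∈?_)
open import Data.List.Relation.Binary.Permutation.Propositional using (_↭_; ↭-refl; ↭-sym; ↭⇒↭ₛ)
open import Data.List.Relation.Binary.Permutation.Propositional.Properties using (All-resp-↭; ∈-resp-↭; ↭-length; ++-comm; ++-commutativeMonoid)
open import Data.Product using (Σ; _×_; _,_; proj₁; proj₂)
open import Data.Sum using (_⊎_; inj₁; inj₂)
open import Data.Empty using (⊥; ⊥-elim)
open import Relation.Binary.PropositionalEquality using (_≡_; _≢_; refl; sym; trans; cong; cong₂; subst; ≢-sym; setoid; module ≡-Reasoning)
open import Data.List.Relation.Binary.Permutation.Setoid.Properties (setoid ℕ) using (Unique-resp-↭)
open import Relation.Nullary using (¬_; Dec; yes; no)
open import Relation.Unary using (Decidable)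
import Algebra.Solver.Monoid
import Algebra.Solver.CommutativeMonoid

module ++-Solver = Algebra.Solver.Monoid (++-monoid ℕ)
module ↭-Solver = Algebra.Solver.CommutativeMonoid (++-commutativeMonoid {A = ℕ})


-- Successors in G_B(p * d, d).

-- The successors of x are the d vertices (x % p) * d + r with r < d, so a vertex y is a
-- successor of x exactly when y / d = x % p (this lemma and the next one).
successor-quotient : ∀ p d {x y} .{{_ : NonZero p}} .{{_ : NonZero d}} →
  Edge (p * d) d x y → y / d ≡ x % p
successor-quotient p d {x} {y} (_ , y<N , r , r<d , q , eq) = begin
  y / d                   ≡⟨ cong (_/ d) y-decomposed ⟩
  (x % p * d + r) / d     ≡⟨ +-distrib-/-∣ˡ r (n∣m*n (x % p)) ⟩
  x % p * d / d + r / d   ≡⟨ cong₂ _+_ (m*n/n≡m (x % p) d) (m<n⇒m/n≡0 r<d) ⟩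
  x % p + 0               ≡⟨ +-identityʳ (x % p) ⟩
  x % p                   ∎
  where
  open ≡-Reasoning
  instance _ = m*n≢0 p d
  y-decomposed : y ≡ x % p * d + r
  y-decomposed = begin
    y                             ≡⟨ m<n⇒m%n≡m y<N ⟨
    y % (p * d)                   ≡⟨ [m+kn]%n≡m%n y q (p * d) ⟨
    (y + q * (p * d)) % (p * d)   ≡⟨ cong (_% (p * d)) (trans (+-comm y _) (sym eq)) ⟩
    (d * x + r) % (p * d)         ≡⟨ cong (λ t → (t + r) % (p * d)) (*-comm d x) ⟩
    (x * d + r) % (p * d)         ≡⟨ [m*n+o]%[p*n]≡[m*n]%[p*n]+o x p r<d ⟩
    x * d % (p * d) + r           ≡⟨ cong (_+ r) (m%n*o≡m*o%[n*o] x p d) ⟨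
    x % p * d + r                 ∎

quotient-successor : ∀ p d {x y} .{{_ : NonZero p}} .{{_ : NonZero d}} →
  x < p * d → y < p * d → y / d ≡ x % p → Edge (p * d) d x y
quotient-successor p d {x} {y} x<N y<N y/d≡x%p =
  x<N , y<N , y % d , m%n<n y d , q , (begin
    d * x + y % d                          ≡⟨ cong (_+ y % d) (*-comm d x) ⟩
    x * d + y % d                          ≡⟨ cong (_+ y % d) (m≡m%n+[m/n]*n (x * d) (p * d)) ⟩
    x * d % (p * d) + q * (p * d) + y % d  ≡⟨ cong (λ t → t + q * (p * d) + y % d) (m%n*o≡m*o%[n*o] x p d) ⟨
    x % p * d + q * (p * d) + y % d        ≡⟨ +-assoc (x % p * d) _ _ ⟩
    x % p * d + (q * (p * d) + y % d)      ≡⟨ +-comm (x % p * d) _ ⟩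
    q * (p * d) + y % d + x % p * d        ≡⟨ +-assoc (q * (p * d)) _ _ ⟩
    q * (p * d) + (y % d + x % p * d)      ≡⟨ cong (λ t → q * (p * d) + (y % d + t * d)) y/d≡x%p ⟨
    q * (p * d) + (y % d + y / d * d)      ≡⟨ cong (q * (p * d) +_) (m≡m%n+[m/n]*n y d) ⟨
    q * (p * d) + y                        ∎)
  where
  open ≡-Reasoning
  instance _ = m*n≢0 p d
  q : ℕ
  q = x * d / (p * d)

sibling-successor : ∀ {N d a a' b c} → d ∣ N →
  Edge N d a b → Edge N d a' b → Edge N d a c → Edge N d a' c
sibling-successor {d = d} {a} {a'} {b} {c} (divides p refl)
  a→b@(a<N , _ , _ , r<d , _) a'→b@(a'<N , _) a→c@(_ , c<N , _) =
  quotient-successor p d a'<N c<N (begin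
    c / d   ≡⟨ successor-quotient p d a→c ⟩
    a % p   ≡⟨ successor-quotient p d a→b ⟨
    b / d   ≡⟨ successor-quotient p d a'→b ⟩
    a' % p  ∎)
  where
  open ≡-Reasoning
  instance
    d≢0 : NonZero d
    d≢0 = >-nonZero (≤-<-trans z≤n r<d)
    p≢0 : NonZero p
    p≢0 = m*n≢0⇒m≢0 p {{>-nonZero (≤-<-trans z≤n a<N)}}

siblings-conjugate : ∀ {N d a a' y y'} → d ∣ N → a ≢ a' → y ≢ y' →
  Edge N d a y → Edge N d a y' → Edge N d a' y → Conjugate N d a a'
siblings-conjugate d∣N a≢a' y≢y' a→y a→y' a'→y =
  a≢a' , _ , _ , y≢y' , a→y , a→y' , a'→y , sibling-successor d∣N a→y a'→y a→y'


-- Successor functions made of edges.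

EdgeFunction : ℕ → ℕ → (ℕ → ℕ) → Set
EdgeFunction N d g = ∀ z → z < N → Edge N d z (g z)

swapSucc-first : ∀ g a b → swapSucc g a b a ≡ g b
swapSucc-first g a b with a ≟ a
... | yes _ = refl
... | no a≢a = ⊥-elim (a≢a refl)

swapSucc-second : ∀ g a b → a ≢ b → swapSucc g a b b ≡ g a
swapSucc-second g a b a≢b with b ≟ a
... | yes b≡a = ⊥-elim (a≢b (sym b≡a))
... | no _ with b ≟ b
...   | yes _ = refl
...   | no b≢b = ⊥-elim (b≢b refl)

swapSucc-other : ∀ g a b z → z ≢ a → z ≢ b → swapSucc g a b z ≡ g z
swapSucc-other g a b z z≢a z≢b with z ≟ a
... | yes z≡a = ⊥-elim (z≢a z≡a)
... | no _ with z ≟ b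
...   | yes z≡b = ⊥-elim (z≢b z≡b)
...   | no _ = refl

swapSucc-edges : ∀ {N d g a b y} → d ∣ N → EdgeFunction N d g →
  Edge N d a y → Edge N d b y → EdgeFunction N d (swapSucc g a b)
swapSucc-edges {a = a} {b} d∣N g-edges a→y b→y z z<N with z ≟ a
... | yes refl = sibling-successor d∣N b→y a→y (g-edges b (proj₁ b→y))
... | no _ with z ≟ b
...   | yes refl = sibling-successor d∣N a→y b→y (g-edges a (proj₁ a→y))
...   | no _ = g-edges z z<N


Last : List ℕ → ℕ → Set
Last A z = Σ (List ℕ) λ A' → A ≡ A' ++ [ z ]

Head : List ℕ → ℕ → Set
Head B y = Σ (List ℕ) λ B' → B ≡ y ∷ B'

last-unique : ∀ {A z z'} → Last A z → Last A z' → z ≡ z'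
last-unique (A₁ , refl) (A₂ , eq) = proj₂ (∷ʳ-injective A₁ A₂ eq)

head-unique : ∀ {B y y'} → Head B y → Head B y' → y ≡ y'
head-unique (_ , refl) (_ , eq) = proj₁ (∷-injective eq)

last-∈ : ∀ {A z} → Last A z → z ∈ A
last-∈ (A' , refl) = ∈-++⁺ʳ A' (here refl)

head-∈ : ∀ {B y} → Head B y → y ∈ B
head-∈ (_ , refl) = here refl

last-++ : ∀ A {B z} → Last B z → Last (A ++ B) z
last-++ A {z = z} (B' , refl) = A ++ B' , sym (++-assoc A B' [ z ])

head-++ : ∀ {A y} B → Head A y → Head (A ++ B) y
head-++ B (A' , refl) = A' ++ B , refl

head-same-start : ∀ A {c C C' y} → Head (A ++ c ∷ C) y → Head (A ++ c ∷ C') y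
head-same-start [] (_ , refl) = _ , refl
head-same-start (_ ∷ _) (_ , refl) = _ , refl

lastOf : ℕ → List ℕ → ℕ
lastOf a [] = a
lastOf _ (h ∷ t) = lastOf h t

last-lastOf : ∀ a l → Last (a ∷ l) (lastOf a l)
last-lastOf a [] = [] , refl
last-lastOf a (h ∷ t) with last-lastOf h t
... | A' , eq = a ∷ A' , cong (a ∷_) eq

last-of-nonempty : ∀ {A a} → Head A a → Σ ℕ (Last A)
last-of-nonempty (A' , refl) = _ , last-lastOf _ A'

last-of-suffix : ∀ A {c C z} → Last (A ++ c ∷ C) z → Last (c ∷ C) z
last-of-suffix A {c} {C} A-last =
  subst (Last (c ∷ C)) (last-unique (last-++ A (last-lastOf c C)) A-last) (last-lastOf c C)

-- Rotating β = β₁ ++ b ∷ β₂ (first entry y₁, last entry x') to start at b: either b was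
-- already first and the rotation ends at x', or β₁ is a nonempty block from y₁ to the new
-- last entry.
rotation-cases : ∀ β₁ {b β₂ y₁ x'} → Head (β₁ ++ b ∷ β₂) y₁ → Last (β₁ ++ b ∷ β₂) x' →
  (b ≡ y₁ × lastOf b (β₂ ++ β₁) ≡ x') ⊎ (Head β₁ y₁ × Last β₁ (lastOf b (β₂ ++ β₁)))
rotation-cases [] {b} {β₂} (_ , refl) β-last rewrite ++-identityʳ β₂ =
  inj₁ (refl , last-unique (last-lastOf b β₂) β-last)
rotation-cases (h ∷ t) {b} {β₂} (_ , refl) _ =
  inj₂ ((t , refl) , last-of-suffix (b ∷ β₂) (last-lastOf b (β₂ ++ h ∷ t)))


adj-cast : ∀ {l l'} → l ≡ l' → ∀ {z y} → Adj l z y → Adj l' z y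
adj-cast refl arrow = arrow

adj-++ˡ : ∀ {A} B {z y} → Adj A z y → Adj (A ++ B) z y
adj-++ˡ B {z} {y} (as , bs , refl) = as , bs ++ B , ++-assoc as (z ∷ y ∷ bs) B

adj-++ʳ : ∀ A {B z y} → Adj B z y → Adj (A ++ B) z y
adj-++ʳ A (as , bs , refl) = A ++ as , bs , sym (++-assoc A as _)

adj-join : ∀ {A B z y} → Last A z → Head B y → Adj (A ++ B) z y
adj-join {z = z} {y} (A' , refl) (B' , refl) = A' , B' , ++-assoc A' [ z ] (y ∷ B')

adj-∈ˡ : ∀ {A z y} → Adj A z y → z ∈ A
adj-∈ˡ (as , _ , refl) = ∈-++⁺ʳ as (here refl)

adj-∈ʳ : ∀ {A z y} → Adj A z y → y ∈ A
adj-∈ʳ (as , _ , refl) = ∈-++⁺ʳ as (there (here refl))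

adj-singleton : ∀ {a z y} → ¬ Adj [ a ] z y
adj-singleton ([] , _ , ())
adj-singleton (_ ∷ [] , _ , ())
adj-singleton (_ ∷ _ ∷ _ , _ , ())

adj-split : ∀ A {B z y} → Adj (A ++ B) z y → Adj A z y ⊎ (Last A z × Head B y) ⊎ Adj B z y
adj-split [] arrow = inj₂ (inj₂ arrow)
adj-split (h ∷ []) ([] , bs , refl) = inj₂ (inj₁ (([] , refl) , (bs , refl)))
adj-split (h ∷ h' ∷ A) ([] , _ , refl) = inj₁ ([] , A , refl)
adj-split (h ∷ A) (_ ∷ as , bs , eq) with adj-split A (as , bs , proj₂ (∷-injective eq))
... | inj₁ inA = inj₁ (adj-++ʳ [ h ] inA)
... | inj₂ (inj₁ (A-last , B-head)) = inj₂ (inj₁ (last-++ [ h ] A-last , B-head))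
... | inj₂ (inj₂ inB) = inj₂ (inj₂ inB)

adj-blocks : ∀ Cs B {z y} → Adj (foldr _++_ B Cs) z y →
  Any (λ C → Adj C z y) (B ∷ Cs) ⊎ Any (λ C → Last C z) Cs
adj-blocks [] B arrow = inj₁ (here arrow)
adj-blocks (C ∷ Cs) B arrow with adj-split C arrow
... | inj₁ inC = inj₁ (there (here inC))
... | inj₂ (inj₁ (C-last , _)) = inj₂ (here C-last)
... | inj₂ (inj₂ later) with adj-blocks Cs B later
...   | inj₁ (here inB) = inj₁ (here inB)
...   | inj₁ (there inCs) = inj₁ (there (there inCs))
...   | inj₂ lastCs = inj₂ (there lastCs)

adj-in-blocks : ∀ Cs B {z y} → Any (λ C → Adj C z y) (B ∷ Cs) → Adj (foldr _++_ B Cs) z y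
adj-in-blocks [] B (here inB) = inB
adj-in-blocks (C ∷ Cs) B (here inB) = adj-++ʳ C (adj-in-blocks Cs B (here inB))
adj-in-blocks (C ∷ Cs) B (there (here inC)) = adj-++ˡ _ inC
adj-in-blocks (C ∷ Cs) B (there (there inCs)) = adj-++ʳ C (adj-in-blocks Cs B (there inCs))

-- The blocks of the new cycle are those of the old one with the 3rd and 5th exchanged.
any-exchange : ∀ {P : List ℕ → Set} {A B C D E} →
  Any P (A ∷ B ∷ C ∷ D ∷ E ∷ []) → Any P (A ∷ B ∷ E ∷ D ∷ C ∷ [])
any-exchange (here pA) = here pA
any-exchange (there (here pB)) = there (here pB)
any-exchange (there (there (here pC))) = there (there (there (there (here pC))))
any-exchange (there (there (there (here pD)))) = there (there (there (here pD)))
any-exchange (there (there (there (there (here pE))))) = there (there (here pE))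


unique-apart : ∀ (A : List ℕ) {B z} → Unique (A ++ B) → z ∈ A → z ∈ B → ⊥
unique-apart (h ∷ A) (h∉A++B ∷ _) (here refl) z∈B = All.lookup h∉A++B (∈-++⁺ʳ A z∈B) refl
unique-apart (h ∷ A) (_ ∷ A++B!) (there z∈A) z∈B = unique-apart A A++B! z∈A z∈B

unique-prefix : ∀ (A : List ℕ) {B} → Unique (A ++ B) → Unique A
unique-prefix [] _ = []
unique-prefix (h ∷ A) (h∉A++B ∷ A++B!) =
  All.tabulate (λ z∈A → All.lookup h∉A++B (∈-++⁺ˡ z∈A)) ∷ unique-prefix A A++B!

unique-suffix : ∀ (A : List ℕ) {B} → Unique (A ++ B) → Unique B
unique-suffix [] B! = B!
unique-suffix (_ ∷ A) (_ ∷ A++B!) = unique-suffix A A++B!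

disjoint⇒≢ : ∀ {A B : List ℕ} {a a'} → (∀ {z} → z ∈ A → z ∈ B → ⊥) → a ∈ A → a' ∈ B → a ≢ a'
disjoint⇒≢ A∩B a∈A a'∈B refl = A∩B a∈A a'∈B

remove-∈ : ∀ (m₁ : List ℕ) {h m₂ z} → z ∈ m₁ ++ h ∷ m₂ → z ≢ h → z ∈ m₁ ++ m₂
remove-∈ [] (here z≡h) z≢h = ⊥-elim (z≢h z≡h)
remove-∈ [] (there z∈m₂) _ = z∈m₂
remove-∈ (_ ∷ m₁) (here refl) _ = here refl
remove-∈ (_ ∷ m₁) (there z∈) z≢h = there (remove-∈ m₁ z∈ z≢h)

length-insert : ∀ (m₁ : List ℕ) {h m₂} → length (m₁ ++ h ∷ m₂) ≡ suc (length (m₁ ++ m₂))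
length-insert [] = refl
length-insert (_ ∷ m₁) = cong suc (length-insert m₁)

unique-length-≤ : ∀ (l : List ℕ) {m} → Unique l → (∀ {z} → z ∈ l → z ∈ m) → length l ≤ length m
unique-length-≤ [] _ _ = z≤n
unique-length-≤ (h ∷ t) (h∉t ∷ t!) l⊆m with ∈-∃++ (l⊆m (here refl))
... | m₁ , m₂ , refl = begin
  suc (length t)           ≤⟨ s≤s (unique-length-≤ t t! t⊆m₁m₂) ⟩
  suc (length (m₁ ++ m₂))  ≡⟨ length-insert m₁ ⟨
  length (m₁ ++ h ∷ m₂)    ∎
  where
  open ≤-Reasoning
  t⊆m₁m₂ : ∀ {z} → z ∈ t → z ∈ m₁ ++ m₂
  t⊆m₁m₂ z∈t = remove-∈ m₁ (l⊆m (there z∈t)) (λ z≡h → All.lookup h∉t z∈t (sym z≡h))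


-- Cycles written as vertex lists.

headOr : ℕ → List ℕ → ℕ
headOr a [] = a
headOr _ (h ∷ _) = h

headOr-head : ∀ l a → Head (l ++ [ a ]) (headOr a l)
headOr-head [] a = [] , refl
headOr-head (h ∷ l) a = l ++ [ a ] , refl

following : List ℕ → ℕ → ℕ → ℕ
following [] a z = a
following (h ∷ t) a z with z ≟ h
... | yes _ = headOr a t
... | no _ = following t a z

cycleSucc : List ℕ → ℕ → ℕ
cycleSucc u = following u 0

adj-source-∈ : ∀ l {a z y} → Adj (l ++ [ a ]) z y → z ∈ l
adj-source-∈ l arrow with adj-split l arrow
... | inj₁ inside = adj-∈ˡ inside
... | inj₂ (inj₁ (z-last , _)) = last-∈ z-last
... | inj₂ (inj₂ inside) = ⊥-elim (adj-singleton inside)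

following-adj : ∀ l a {z} → z ∈ l → Adj (l ++ [ a ]) z (following l a z)
following-adj (h ∷ t) a {z} z∈l with z ≟ h
... | yes refl = adj-join ([] , refl) (headOr-head t a)
... | no z≢h with z∈l
...   | here z≡h = ⊥-elim (z≢h z≡h)
...   | there z∈t = adj-++ʳ [ h ] (following-adj t a z∈t)

adj-following : ∀ l a {z y} → Unique l → Adj (l ++ [ a ]) z y → following l a z ≡ y
adj-following [] a _ arrow = ⊥-elim (adj-singleton arrow)
adj-following (h ∷ t) a {z} (h∉t ∷ t!) arrow with z ≟ h | adj-split [ h ] arrow
... | _ | inj₁ inside = ⊥-elim (adj-singleton inside)
... | yes _ | inj₂ (inj₁ (_ , y-first)) = head-unique (headOr-head t a) y-first
... | yes refl | inj₂ (inj₂ later) = ⊥-elim (All.lookup h∉t (adj-source-∈ t later) refl)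
... | no z≢h | inj₂ (inj₁ (z-last , _)) = ⊥-elim (z≢h (last-unique z-last ([] , refl)))
... | no _ | inj₂ (inj₂ later) = adj-following t a t! later

next-unique : ∀ {u z y y'} → Unique u → Next u z y → Next u z y' → y ≡ y'
next-unique {u} u! arrow arrow' = trans (sym (adj-following u 0 u! arrow)) (adj-following u 0 u! arrow')

path-edge : ∀ {N d l z y} → Path N d l → Adj l z y → Edge N d z y
path-edge nil ([] , _ , ())
path-edge nil (_ ∷ _ , _ , ())
path-edge (one _) arrow = ⊥-elim (adj-singleton arrow)
path-edge (cons _ _ _ e _) ([] , _ , refl) = e
path-edge (cons _ _ _ _ rest) (_ ∷ as , bs , eq) = path-edge rest (as , bs , proj₂ (∷-injective eq))

edges-path : ∀ {N d} l → (∀ {z y} → Adj l z y → Edge N d z y) → Path N d l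
edges-path [] _ = nil
edges-path (z ∷ []) _ = one z
edges-path (z ∷ y ∷ l) edges =
  cons z y l (edges ([] , l , refl)) (edges-path (y ∷ l) (λ arrow → edges (adj-++ʳ [ z ] arrow)))

cycle-edge : ∀ {N d u z y} → DBCycle N d u → Next u z y → Edge N d z y
cycle-edge cyc = path-edge (DBCycle.closed cyc)

cycle-vertex : ∀ {N d u z} → DBCycle N d u → z ∈ u → z < N
cycle-vertex cyc = All.lookup (DBCycle.inV cyc)

-- A de Bruijn cycle passes through every vertex (by pigeonhole).
contains-all-vertices : ∀ {N d u z} → DBCycle N d u → z < N → z ∈ u
contains-all-vertices {N} {u = u} {z} cyc z<N with z ∈? u
... | yes z∈u = z∈u
... | no z∉u = ⊥-elim (<-irrefl refl (begin-strict
  N                        ≡⟨ len ⟨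
  length u                 <⟨ n<1+n (length u) ⟩
  length (z ∷ u)           ≤⟨ unique-length-≤ (z ∷ u) z∷u! z∷u⊆upTo ⟩
  length (upTo N)          ≡⟨ length-upTo N ⟩
  N                        ∎))
  where
  open DBCycle cyc
  open ≤-Reasoning
  z∷u! : Unique (z ∷ u)
  z∷u! = All.tabulate (λ z'∈u z≡z' → z∉u (subst (_∈ u) (sym z≡z') z'∈u)) ∷ distinct
  z∷u⊆upTo : ∀ {z'} → z' ∈ z ∷ u → z' ∈ upTo N
  z∷u⊆upTo (here refl) = ∈-upTo⁺ z<N
  z∷u⊆upTo (there z'∈u) = ∈-upTo⁺ (All.lookup inV z'∈u)

rearranged-cycle : ∀ {N d u u₁ g} → DBCycle N d u → u₁ ↭ u → Head u₁ 0 → EdgeFunction N d g →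
  (∀ z → z < N → Next u₁ z (g z)) → DBCycle N d u₁
rearranged-cycle {N} {d} {u} {u₁} {g} cyc u₁↭u u₁-head g-edges u₁-arrows = record
  { len = trans (↭-length u₁↭u) len
  ; inV = inV₁
  ; distinct = distinct₁
  ; start = u₁-head
  ; closed = edges-path (u₁ ++ [ 0 ]) arrow-edge
  }
  where
  open DBCycle cyc
  inV₁ : All (_< N) u₁
  inV₁ = All-resp-↭ (↭-sym u₁↭u) inV
  distinct₁ : Unique u₁
  distinct₁ = Unique-resp-↭ (↭⇒↭ₛ (↭-sym u₁↭u)) distinct
  arrow-edge : ∀ {z y} → Next u₁ z y → Edge N d z y
  arrow-edge {z} arrow = subst (Edge N d z) (next-unique distinct₁ (u₁-arrows z z<N) arrow) (g-edges z z<N)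
    where
    z<N : z < N
    z<N = All.lookup inV₁ (adj-source-∈ u₁ arrow)


-- Comparing two cycles.

first-divergence : ∀ (u v : List ℕ) → length u ≡ length v → u ≢ v →
  Σ (List ℕ) λ α → Σ ℕ λ y₁ → Σ ℕ λ y₂ → Σ (List ℕ) λ ρ → Σ (List ℕ) λ σ →
    u ≡ α ++ y₁ ∷ ρ × v ≡ α ++ y₂ ∷ σ × y₁ ≢ y₂ × lcp u v ≡ length α
first-divergence [] [] _ u≢v = ⊥-elim (u≢v refl)
first-divergence (x ∷ xs) (y ∷ ys) same-length u≢v with x ≟ y
... | no x≢y = [] , x , y , xs , ys , refl , refl , x≢y , refl
... | yes refl with first-divergence xs ys (cong pred same-length) (λ xs≡ys → u≢v (cong (x ∷_) xs≡ys))
...   | α , y₁ , y₂ , ρ , σ , refl , refl , y₁≢y₂ , lcp≡ =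
  x ∷ α , y₁ , y₂ , ρ , σ , refl , refl , y₁≢y₂ , cong suc lcp≡

lcp-cons : ∀ a l l' → lcp (a ∷ l) (a ∷ l') ≡ suc (lcp l l')
lcp-cons a l l' with a ≟ a
... | yes _ = refl
... | no a≢a = ⊥-elim (a≢a refl)

lcp-shared-prefix : ∀ (α : List ℕ) y τ σ → suc (length α) ≤ lcp (α ++ y ∷ τ) (α ++ y ∷ σ)
lcp-shared-prefix [] y τ σ = subst (1 ≤_) (sym (lcp-cons y τ σ)) (s≤s z≤n)
lcp-shared-prefix (a ∷ α) y τ σ =
  subst (suc (suc (length α)) ≤_) (sym (lcp-cons a _ _)) (s≤s (lcp-shared-prefix α y τ σ))

prefix-shorter : ∀ (α : List ℕ) {y ρ} → length α < length (α ++ y ∷ ρ)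
prefix-shorter α = subst (length α <_) (sym (length-++ α)) (m<m+n (length α) (s≤s z≤n))

-- Two cycles written from 0 that differ right after α: α is nonempty, so it starts at 0.
divergence-after-start : ∀ (α : List ℕ) {y₁ y₂ ρ σ} → y₁ ≢ y₂ →
  Head (α ++ y₁ ∷ ρ) 0 → Head (α ++ y₂ ∷ σ) 0 → Head α 0
divergence-after-start [] y₁≢y₂ (_ , refl) (_ , refl) = ⊥-elim (y₁≢y₂ refl)
divergence-after-start (_ ∷ α) _ (_ , refl) _ = α , refl

first-entry : ∀ {P : ℕ → Set} → Decidable P → ∀ h t {z} → ¬ P h → z ∈ h ∷ t → P z →
  Σ ℕ λ w → Σ ℕ λ b → Adj (h ∷ t) w b × ¬ P w × P b
first-entry P? h t ¬Ph (here refl) Pz = ⊥-elim (¬Ph Pz)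
first-entry P? h (h' ∷ t) ¬Ph (there z∈) Pz with P? h'
... | yes Ph' = h , h' , ([] , t , refl) , ¬Ph , Ph'
... | no ¬Ph' with first-entry P? h' t ¬Ph' z∈ Pz
...   | w , b , step , ¬Pw , Pb = w , b , adj-++ʳ [ h ] step , ¬Pw , Pb

divergent-vertex-later : ∀ {N d} α {y₁ y₂ ρ σ} → y₁ ≢ y₂ →
  DBCycle N d (α ++ y₁ ∷ ρ) → DBCycle N d (α ++ y₂ ∷ σ) → y₂ ∈ ρ
divergent-vertex-later α y₁≢y₂ cu cv
  with ∈-++⁻ α (contains-all-vertices cu (cycle-vertex cv (∈-++⁺ʳ α (here refl))))
... | inj₁ y₂∈α = ⊥-elim (unique-apart α (DBCycle.distinct cv) y₂∈α (here refl))
... | inj₂ (here y₂≡y₁) = ⊥-elim (y₁≢y₂ (sym y₂≡y₁))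
... | inj₂ (there y₂∈ρ) = y₂∈ρ

-- With u = α β γ for β = y₁ ρ₁ and γ = y₂ ρ₂, following v = α y₂ … until it first enters β
-- gives an edge from γ into β.
entering-edge : ∀ {N d} α {y₁ y₂} ρ₁ ρ₂ {σ} →
  DBCycle N d (α ++ (y₁ ∷ ρ₁) ++ (y₂ ∷ ρ₂)) → DBCycle N d (α ++ y₂ ∷ σ) →
  Σ ℕ λ w → Σ ℕ λ b → w ∈ y₂ ∷ ρ₂ × b ∈ y₁ ∷ ρ₁ × Edge N d w b
entering-edge {N} {d} α {y₁} {y₂} ρ₁ ρ₂ {σ} cu cv =
  enter (first-entry (_∈? β) y₂ σ y₂∉β y₁∈v-tail (here refl))
  where
  β γ : List ℕ
  β = y₁ ∷ ρ₁
  γ = y₂ ∷ ρ₂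
  y₂∉β : y₂ ∉ β
  y₂∉β y₂∈β = unique-apart β (unique-suffix α (DBCycle.distinct cu)) y₂∈β (here refl)
  y₁∈v-tail : y₁ ∈ y₂ ∷ σ
  y₁∈v-tail with ∈-++⁻ α (contains-all-vertices cv (cycle-vertex cu (∈-++⁺ʳ α (here refl))))
  ... | inj₁ y₁∈α = ⊥-elim (unique-apart α (DBCycle.distinct cu) y₁∈α (here refl))
  ... | inj₂ y₁∈v-tail = y₁∈v-tail
  enter : (Σ ℕ λ w → Σ ℕ λ b → Adj (y₂ ∷ σ) w b × w ∉ β × b ∈ β) →
    Σ ℕ λ w → Σ ℕ λ b → w ∈ γ × b ∈ β × Edge N d w b
  enter (w , b , step , w∉β , b∈β) = w , b , w∈γ , b∈β , cycle-edge cv (adj-++ˡ [ 0 ] (adj-++ʳ α step))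
    where
    w∈v-tail : w ∈ y₂ ∷ σ
    w∈v-tail = adj-∈ˡ step
    w∈γ : w ∈ γ
    w∈γ with ∈-++⁻ α (contains-all-vertices cu (cycle-vertex cv (∈-++⁺ʳ α w∈v-tail)))
    ... | inj₁ w∈α = ⊥-elim (unique-apart α (DBCycle.distinct cv) w∈α w∈v-tail)
    ... | inj₂ w∈βγ with ∈-++⁻ β w∈βγ
    ...   | inj₁ w∈β = ⊥-elim (w∉β w∈β)
    ...   | inj₂ in-γ = in-γ


-- The cross-join step.  u = α β γ with β = β₁ b β₂ and γ = γ₁ w γ₂, where α runs from 0
-- to x, β from y₁ to x', γ starts at y₂, and x → y₂ and w → b are edges.
module CrossJoinStep
  {N d : ℕ} (d∣N : d ∣ N) (α β₁ β₂ γ₁ γ₂ : List ℕ) (b w : ℕ) {x x' y₁ y₂ : ℕ}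
  (cyc : DBCycle N d (α ++ (β₁ ++ b ∷ β₂) ++ (γ₁ ++ w ∷ γ₂)))
  (α-head : Head α 0) (α-last : Last α x)
  (β-head : Head (β₁ ++ b ∷ β₂) y₁) (β-last : Last (β₁ ++ b ∷ β₂) x')
  (γ-head : Head (γ₁ ++ w ∷ γ₂) y₂)
  (x→y₂ : Edge N d x y₂) (w→b : Edge N d w b)
  where

  open DBCycle cyc

  B₂ β γ u T : List ℕ
  B₂ = b ∷ β₂
  β = β₁ ++ B₂
  γ = γ₁ ++ w ∷ γ₂
  u = α ++ β ++ γ
  T = γ₂ ++ [ 0 ]

  -- p is the last vertex of β rotated to start at b, i.e. the predecessor of b on the
  -- cycle β; c is the successor of w on u.
  p c : ℕ
  p = lastOf b (β₂ ++ β₁)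
  c = headOr 0 γ₂

  p-last : Last (B₂ ++ β₁) p
  p-last = last-lastOf b (β₂ ++ β₁)

  B₂-last : Last B₂ x'
  B₂-last = last-of-suffix β₁ β-last

  -- The new cycle: β, rotated to start at b, inserted into α γ right after w.
  u₁ : List ℕ
  u₁ = α ++ γ₁ ++ w ∷ B₂ ++ β₁ ++ γ₂

  u-closed : u ++ [ 0 ] ≡ α ++ β ++ γ ++ [ 0 ]
  u-closed = solve 4 (λ A B C Z → ((A ⊕ B ⊕ C) ⊕ Z) ⊜ (A ⊕ B ⊕ C ⊕ Z)) refl α β γ [ 0 ]
    where open ++-Solver

  u-blocks : u ++ [ 0 ] ≡ foldr _++_ T (α ∷ β₁ ∷ B₂ ∷ (γ₁ ++ [ w ]) ∷ [])
  u-blocks = solve 7 (λ A B₁ B₂ C₁ W C₂ Z →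
      ((A ⊕ (B₁ ⊕ B₂) ⊕ (C₁ ⊕ W ⊕ C₂)) ⊕ Z) ⊜ (A ⊕ B₁ ⊕ B₂ ⊕ (C₁ ⊕ W) ⊕ C₂ ⊕ Z))
    refl α β₁ B₂ γ₁ [ w ] γ₂ [ 0 ]
    where open ++-Solver

  u₁-blocks : u₁ ++ [ 0 ] ≡ foldr _++_ T (α ∷ (γ₁ ++ [ w ]) ∷ B₂ ∷ β₁ ∷ [])
  u₁-blocks = solve 7 (λ A B₁ B₂ C₁ W C₂ Z →
      ((A ⊕ C₁ ⊕ W ⊕ B₂ ⊕ B₁ ⊕ C₂) ⊕ Z) ⊜ (A ⊕ (C₁ ⊕ W) ⊕ B₂ ⊕ B₁ ⊕ C₂ ⊕ Z))
    refl α β₁ B₂ γ₁ [ w ] γ₂ [ 0 ]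
    where open ++-Solver

  u₁↭u : u₁ ↭ u
  u₁↭u = solve 6 (λ A B₁ B₂ C₁ W C₂ →
      (A ⊕ C₁ ⊕ W ⊕ B₂ ⊕ B₁ ⊕ C₂) ⊜ (A ⊕ (B₁ ⊕ B₂) ⊕ (C₁ ⊕ W ⊕ C₂)))
    ↭-refl α β₁ B₂ γ₁ [ w ] γ₂
    where open ↭-Solver

  α∩β : ∀ {z} → z ∈ α → z ∈ β → ⊥
  α∩β z∈α z∈β = unique-apart α distinct z∈α (∈-++⁺ˡ z∈β)

  α∩γ : ∀ {z} → z ∈ α → z ∈ γ → ⊥
  α∩γ z∈α z∈γ = unique-apart α distinct z∈α (∈-++⁺ʳ β z∈γ)

  β∩γ : ∀ {z} → z ∈ β → z ∈ γ → ⊥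
  β∩γ = unique-apart β (unique-suffix α distinct)

  β∩αγ : ∀ {z} → z ∈ β → z ∈ α ++ γ → ⊥
  β∩αγ z∈β z∈αγ with ∈-++⁻ α z∈αγ
  ... | inj₁ z∈α = α∩β z∈α z∈β
  ... | inj₂ z∈γ = β∩γ z∈β z∈γ

  β₁∩B₂ : ∀ {z} → z ∈ β₁ → z ∈ B₂ → ⊥
  β₁∩B₂ = unique-apart β₁ (unique-prefix β (unique-suffix α distinct))

  x∈α : x ∈ α
  x∈α = last-∈ α-last

  x'∈β : x' ∈ β
  x'∈β = last-∈ β-last

  y₁∈β : y₁ ∈ β
  y₁∈β = head-∈ β-head

  b∈β : b ∈ β
  b∈β = ∈-++⁺ʳ β₁ (here refl)

  p∈β : p ∈ β
  p∈β = ∈-resp-↭ (++-comm B₂ β₁) (last-∈ p-last)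

  y₂∈γ : y₂ ∈ γ
  y₂∈γ = head-∈ γ-head

  w∈γ : w ∈ γ
  w∈γ = ∈-++⁺ʳ γ₁ (here refl)

  x≢x' : x ≢ x'
  x≢x' = disjoint⇒≢ α∩β x∈α x'∈β

  y₁≢y₂ : y₁ ≢ y₂
  y₁≢y₂ = disjoint⇒≢ β∩γ y₁∈β y₂∈γ

  w≢x : w ≢ x
  w≢x = ≢-sym (disjoint⇒≢ α∩γ x∈α w∈γ)

  w≢x' : w ≢ x'
  w≢x' = ≢-sym (disjoint⇒≢ β∩γ x'∈β w∈γ)

  w≢p : w ≢ p
  w≢p = ≢-sym (disjoint⇒≢ β∩γ p∈β w∈γ)

  p≢x : p ≢ x
  p≢x = ≢-sym (disjoint⇒≢ α∩β x∈α p∈β)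

  s : ℕ → ℕ
  s = cycleSucc u

  s-arrow : ∀ z → z < N → Next u z (s z)
  s-arrow z z<N = following-adj u 0 (contains-all-vertices cyc z<N)

  s-value : ∀ {z y} → Next u z y → s z ≡ y
  s-value = adj-following u 0 distinct

  s-edges : EdgeFunction N d s
  s-edges z z<N = cycle-edge cyc (s-arrow z z<N)

  x-arrow : Next u x y₁
  x-arrow = adj-cast (sym u-closed) (adj-join α-last (head-++ (γ ++ [ 0 ]) β-head))

  x'-arrow : Next u x' y₂
  x'-arrow = adj-cast (sym u-closed) (adj-++ʳ α (adj-join β-last (head-++ [ 0 ] γ-head)))

  w-arrow : Next u w c
  w-arrow = adj-cast (sym u-blocks)
    (adj-++ʳ α (adj-++ʳ β₁ (adj-++ʳ B₂ (adj-join (γ₁ , refl) (headOr-head γ₂ 0)))))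

  arrow-stays : ∀ {z y} → z ∈ α ++ γ → z ≢ x → Next u z y → y ∈ α ++ γ
  arrow-stays z∈αγ z≢x arrow with adj-blocks (α ∷ β ∷ []) (γ ++ [ 0 ]) (adj-cast u-closed arrow)
  ... | inj₁ (here in-γ0) with ∈-++⁻ γ (adj-∈ʳ in-γ0)
  ...   | inj₁ y∈γ = ∈-++⁺ʳ α y∈γ
  ...   | inj₂ (here refl) = ∈-++⁺ˡ (head-∈ α-head)
  arrow-stays z∈αγ z≢x arrow | inj₁ (there (here in-α)) = ∈-++⁺ˡ (adj-∈ʳ in-α)
  arrow-stays z∈αγ z≢x arrow | inj₁ (there (there (here in-β))) = ⊥-elim (β∩αγ (adj-∈ˡ in-β) z∈αγ)
  arrow-stays z∈αγ z≢x arrow | inj₂ (here z-last) = ⊥-elim (z≢x (last-unique z-last α-last))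
  arrow-stays z∈αγ z≢x arrow | inj₂ (there (here z-last)) = ⊥-elim (β∩αγ (last-∈ z-last) z∈αγ)

  b≢c : b ≢ c
  b≢c = disjoint⇒≢ β∩αγ b∈β (arrow-stays (∈-++⁺ʳ α w∈γ) w≢x w-arrow)

  -- The first swap, of the successors of x and x', splits u into the cycles α γ and β.
  f : ℕ → ℕ
  f = swapSucc s x x'

  f-x : f x ≡ y₂
  f-x = trans (swapSucc-first s x x') (s-value x'-arrow)

  f-edges : EdgeFunction N d f
  f-edges = swapSucc-edges d∣N s-edges x→y₂ (cycle-edge cyc x'-arrow)

  x-x'-conjugate : Conjugate N d x x'
  x-x'-conjugate =
    siblings-conjugate d∣N x≢x' (≢-sym y₁≢y₂) x→y₂ (cycle-edge cyc x-arrow) (cycle-edge cyc x'-arrow)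

  f-p : f p ≡ b
  f-p with rotation-cases β₁ β-head β-last
  ... | inj₁ (b≡y₁ , p≡x') = begin
    f p   ≡⟨ cong f p≡x' ⟩
    f x'  ≡⟨ swapSucc-second s x x' x≢x' ⟩
    s x   ≡⟨ s-value x-arrow ⟩
    y₁    ≡⟨ b≡y₁ ⟨
    b     ∎
    where open ≡-Reasoning
  ... | inj₂ (_ , β₁-last) = trans (swapSucc-other s x x' p p≢x p≢x') (s-value p-arrow)
    where
    p≢x' : p ≢ x'
    p≢x' = disjoint⇒≢ β₁∩B₂ (last-∈ β₁-last) (last-∈ B₂-last)
    p-arrow : Next u p b
    p-arrow = adj-cast (sym u-blocks) (adj-++ʳ α (adj-join β₁-last (β₂ ++ _ , refl)))

  p→b : Edge N d p b
  p→b = subst (Edge N d p) f-p (f-edges p (cycle-vertex cyc (∈-++⁺ʳ α (∈-++⁺ˡ p∈β))))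

  w-p-conjugate : Conjugate N d w p
  w-p-conjugate = siblings-conjugate d∣N w≢p b≢c w→b (cycle-edge cyc w-arrow) p→b

  f-keeps-αγ : ∀ {z} → z ∈ α ++ γ → f z ∈ α ++ γ
  f-keeps-αγ {z} z∈αγ = by-cases (z ≟ x)
    where
    z≢x' : z ≢ x'
    z≢x' = ≢-sym (disjoint⇒≢ β∩αγ x'∈β z∈αγ)
    z∈u : z ∈ u
    z∈u with ∈-++⁻ α z∈αγ
    ... | inj₁ z∈α = ∈-++⁺ˡ z∈α
    ... | inj₂ z∈γ = ∈-++⁺ʳ α (∈-++⁺ʳ β z∈γ)
    by-cases : Dec (z ≡ x) → f z ∈ α ++ γ
    by-cases (yes refl) = subst (_∈ α ++ γ) (sym f-x) (∈-++⁺ʳ α y₂∈γ)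
    by-cases (no z≢x) = subst (_∈ α ++ γ) (sym (swapSucc-other s x x' z z≢x z≢x'))
                          (arrow-stays z∈αγ z≢x (s-arrow z (cycle-vertex cyc z∈u)))

  w-p-separated : ¬ SameCycle f w p
  w-p-separated (k , fᵏw≡p) = β∩αγ p∈β (subst (_∈ α ++ γ) fᵏw≡p (orbit k))
    where
    orbit : ∀ k → iter f k w ∈ α ++ γ
    orbit zero = ∈-++⁺ʳ α w∈γ
    orbit (suc k) = f-keeps-αγ (orbit k)

  -- The second swap, of the successors of w and p, joins the two cycles into u₁.
  F : ℕ → ℕ
  F = swapSucc f w p

  F-edges : EdgeFunction N d F
  F-edges = swapSucc-edges d∣N f-edges w→b p→b

  u₁-w-arrow : Next u₁ w (F w)
  u₁-w-arrow = subst (Next u₁ w) (sym (trans (swapSucc-first f w p) f-p))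
    (adj-cast (sym u₁-blocks) (adj-++ʳ α (adj-join (γ₁ , refl) (β₂ ++ β₁ ++ T , refl))))

  u₁-p-arrow : Next u₁ p (F p)
  u₁-p-arrow = subst (Next u₁ p) (sym F-p)
    (adj-cast (sym u₁-blocks) (adj-++ʳ α (adj-++ʳ (γ₁ ++ [ w ])
      (adj-cast (++-assoc B₂ β₁ T) (adj-join p-last (headOr-head γ₂ 0))))))
    where
    F-p : F p ≡ c
    F-p = trans (swapSucc-second f w p w≢p) (trans (swapSucc-other s x x' w w≢x w≢x') (s-value w-arrow))

  u₁-x-arrow : Next u₁ x (F x)
  u₁-x-arrow = subst (Next u₁ x) (sym (trans (swapSucc-other f w p x (≢-sym w≢x) (≢-sym p≢x)) f-x))
    (adj-cast (sym u₁-blocks) (adj-join α-last (head-++ _ (head-same-start γ₁ γ-head))))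

  u₁-x'-arrow : x' ≢ p → Next u₁ x' (F x')
  u₁-x'-arrow x'≢p with rotation-cases β₁ β-head β-last
  ... | inj₁ (_ , p≡x') = ⊥-elim (x'≢p (sym p≡x'))
  ... | inj₂ (β₁-head , _) = subst (Next u₁ x') (sym F-x')
    (adj-cast (sym u₁-blocks) (adj-++ʳ α (adj-++ʳ (γ₁ ++ [ w ]) (adj-join B₂-last (head-++ T β₁-head)))))
    where
    F-x' : F x' ≡ y₁
    F-x' = trans (swapSucc-other f w p x' (≢-sym w≢x') x'≢p)
             (trans (swapSucc-second s x x' x≢x') (s-value x-arrow))

  -- Every other arrow of u lies inside one of the blocks α, β₁, b β₂, γ₁ w, γ₂ 0, which
  -- u₁ merely reorders.
  unchanged-arrow : ∀ {z y} → z ≢ x → z ≢ x' → z ≢ w → z ≢ p → Next u z y → Next u₁ z y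
  unchanged-arrow z≢x z≢x' z≢w z≢p arrow
    with adj-blocks (α ∷ β₁ ∷ B₂ ∷ (γ₁ ++ [ w ]) ∷ []) T (adj-cast u-blocks arrow)
  ... | inj₁ in-block =
    adj-cast (sym u₁-blocks)
      (adj-in-blocks (α ∷ (γ₁ ++ [ w ]) ∷ B₂ ∷ β₁ ∷ []) T (any-exchange in-block))
  ... | inj₂ (here z-last) = ⊥-elim (z≢x (last-unique z-last α-last))
  ... | inj₂ (there (here z-last)) = ⊥-elim (z≢p (last-unique (last-++ B₂ z-last) p-last))
  ... | inj₂ (there (there (here z-last))) = ⊥-elim (z≢x' (last-unique z-last B₂-last))
  ... | inj₂ (there (there (there (here z-last)))) = ⊥-elim (z≢w (last-unique z-last (γ₁ , refl)))

  u₁-arrows : ∀ z → z < N → Next u₁ z (F z)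
  u₁-arrows z z<N = by-cases (z ≟ w) (z ≟ p) (z ≟ x) (z ≟ x')
    where
    by-cases : Dec (z ≡ w) → Dec (z ≡ p) → Dec (z ≡ x) → Dec (z ≡ x') → Next u₁ z (F z)
    by-cases (yes refl) _ _ _ = u₁-w-arrow
    by-cases (no _) (yes refl) _ _ = u₁-p-arrow
    by-cases (no _) (no _) (yes refl) _ = u₁-x-arrow
    by-cases (no _) (no z≢p) (no _) (yes refl) = u₁-x'-arrow z≢p
    by-cases (no z≢w) (no z≢p) (no z≢x) (no z≢x') =
      subst (Next u₁ z) (sym (trans (swapSucc-other f w p z z≢w z≢p) (swapSucc-other s x x' z z≢x z≢x')))
        (unchanged-arrow z≢x z≢x' z≢w z≢p (s-arrow z z<N))

  u₁-cycle : DBCycle N d u₁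
  u₁-cycle = rearranged-cycle cyc u₁↭u (head-++ _ α-head) F-edges u₁-arrows

  u-to-u₁ : CrossJoin N d u u₁
  u-to-u₁ = s , s-arrow , x , x' , x-x'-conjugate , w , p , w-p-conjugate , w-p-separated , u₁-arrows

  u₁-prefix : Σ (List ℕ) λ τ → u₁ ≡ α ++ y₂ ∷ τ
  u₁-prefix with head-same-start γ₁ {C' = B₂ ++ β₁ ++ γ₂} γ-head
  ... | τ , γ₁w…≡y₂τ = τ , cong (α ++_) γ₁w…≡y₂τ


extend-common-prefix : ∀ {N d} → d ∣ N → ∀ α {y₁ y₂ ρ σ} → y₁ ≢ y₂ →
  DBCycle N d (α ++ y₁ ∷ ρ) → DBCycle N d (α ++ y₂ ∷ σ) →
  Σ (List ℕ) λ u₁ → DBCycle N d u₁ × CrossJoin N d (α ++ y₁ ∷ ρ) u₁ ×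
    Σ (List ℕ) λ τ → u₁ ≡ α ++ y₂ ∷ τ
extend-common-prefix {N} {d} d∣N α {y₁} {y₂} {ρ} {σ} y₁≢y₂ cu cv
  with ∈-∃++ (divergent-vertex-later α y₁≢y₂ cu cv)
... | ρ₁ , ρ₂ , refl with entering-edge α ρ₁ ρ₂ cu cv
...   | w , b , w∈γ , b∈β , w→b with ∈-∃++ w∈γ | ∈-∃++ b∈β
...     | γ₁ , γ₂ , γ-split | β₁ , β₂ , β-split =
  Step.u₁ , Step.u₁-cycle ,
  subst (λ u → CrossJoin N d u Step.u₁) (sym u-split) Step.u-to-u₁ , Step.u₁-prefix
  where
  u-split : α ++ (y₁ ∷ ρ₁) ++ (y₂ ∷ ρ₂) ≡ α ++ (β₁ ++ b ∷ β₂) ++ (γ₁ ++ w ∷ γ₂)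
  u-split = cong₂ (λ B G → α ++ B ++ G) β-split γ-split
  α-head : Head α 0
  α-head = divergence-after-start α y₁≢y₂ (DBCycle.start cu) (DBCycle.start cv)
  α-last : Last α (proj₁ (last-of-nonempty α-head))
  α-last = proj₂ (last-of-nonempty α-head)
  module Step = CrossJoinStep d∣N α β₁ β₂ γ₁ γ₂ b w (subst (DBCycle N d) u-split cu)
    α-head α-last
    (subst (λ l → Head l y₁) β-split (ρ₁ , refl))
    (subst (λ l → Last l (lastOf y₁ ρ₁)) β-split (last-lastOf y₁ ρ₁))
    (subst (λ l → Head l y₂) γ-split (ρ₂ , refl))
    (cycle-edge cv (adj-++ˡ [ 0 ] (adj-join α-last (σ , refl))))
    w→b


mainTheorem3 : (N d : ℕ) → 2 ≤ d → d < N → d ∣ N →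
    (u v : List ℕ) → DBCycle N d u → DBCycle N d v → u ≢ v →
    Σ (List ℕ) λ u₁ → DBCycle N d u₁ × CJAdjacent N d u u₁ ×
      Dist N u₁ v < Dist N u v
mainTheorem3 N d _ _ d∣N u v cu cv u≢v
  with first-divergence u v (trans (DBCycle.len cu) (sym (DBCycle.len cv))) u≢v
... | α , y₁ , y₂ , ρ , σ , refl , refl , y₁≢y₂ , lcp≡|α|
  with extend-common-prefix d∣N α y₁≢y₂ cu cv
...   | u₁ , u₁-cycle , u-to-u₁ , τ , refl = u₁ , u₁-cycle , inj₁ u-to-u₁ , (begin-strict
  N ∸ lcp (α ++ y₂ ∷ τ) (α ++ y₂ ∷ σ)  ≤⟨ ∸-monoʳ-≤ N (lcp-shared-prefix α y₂ τ σ) ⟩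
  N ∸ suc (length α)                   <⟨ ∸-monoʳ-< (n<1+n (length α)) |α|<N ⟩
  N ∸ length α                         ≡⟨ cong (N ∸_) lcp≡|α| ⟨
  N ∸ lcp (α ++ y₁ ∷ ρ) (α ++ y₂ ∷ σ)  ∎)
  where
  open ≤-Reasoning
  |α|<N : length α < N
  |α|<N = subst (length α <_) (DBCycle.len cu) (prefix-shorter α)
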